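{- Let $C_n$ be the cycle graph on $n\ge4$ vertices. Then $\ell(C_n)=2n-2$.
   Context: A word $w$ over the alphabet $V$ word-represents a graph $G=(V,E)$ if $w$ contains every letter of $V$ at least once and for all distinct $x,y\in V$, $xy\in E$ if and only if $x$ and $y$ alternate in $w$ (the subword of $w$ consisting only of occurrences of $x$ and $y$ has no two equal consecutive letters). $\ell(G)$ is the minimum length of a word that word-represents $G$. -}

module Defs where

open import Data.Nat using (ℕ; suc; _+_; _%_; NonZero; _≤_; s≤s)
open import Data.Fin using (Fin; toℕ)
open import Data.List using (List; []; _∷_; length; filter)
open import Data.List.Membership.Propositional using (_∈_)
open import Data.Product using (_×_)
open import Data.Sum using (_⊎_)
open import Data.Unit using (⊤)
open import Relation.Nullary using (¬_; Dec)
open import Relation.Binary.PropositionalEquality using (_≡_)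
open import Relation.Nullary.Decidable using (_⊎-dec_)
open import Data.Fin using (_≟_)

-- A graph on vertex set Fin n is given by its (symmetric, irreflexive) edge relation.
Graph : ℕ → Set₁
Graph n = Fin n → Fin n → Set

Word : ℕ → Set
Word n = List (Fin n)

NoRepeatAdj : ∀ {n} → Word n → Set
NoRepeatAdj []            = ⊤
NoRepeatAdj (a ∷ [])      = ⊤
NoRepeatAdj (a ∷ b ∷ w)   = ¬ (a ≡ b) × NoRepeatAdj (b ∷ w)

restrict : ∀ {n} → Fin n → Fin n → Word n → Word n
restrict x y w = filter (λ z → (z ≟ x) ⊎-dec (z ≟ y)) w

Alternate : ∀ {n} → Word n → Fin n → Fin n → Set
Alternate w x y = NoRepeatAdj (restrict x y w)

Represents : ∀ {n} → Graph n → Word n → Set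
Represents {n} G w =
  (∀ (x : Fin n) → x ∈ w) ×
  (∀ (x y : Fin n) → ¬ (x ≡ y) → (G x y → Alternate w x y) × (Alternate w x y → G x y))

CycleAdj : (n : ℕ) → .{{_ : NonZero n}} → Fin n → Fin n → Set
CycleAdj n i j = (toℕ j ≡ (suc (toℕ i)) % n) ⊎ (toℕ i ≡ (suc (toℕ j)) % n)

nonZero4 : ∀ {n} → 4 ≤ n → NonZero n
nonZero4 (s≤s _) = _

module Submission where

-- Lower bound.  Let w represent Cₙ.  Every vertex occurs in w.  Two letters that occur only
-- once each always alternate, so they must be adjacent in Cₙ; as Cₙ has no triangle for
-- n ≥ 4, at most two letters occur only once.  Since |w| is the sum of the multiplicities of
-- the letters, |w| ≥ 2n − 2 (lemma sum-lower-bound, applied with k = 2).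
--
-- Upper bound.  With vertices 0, …, m (n = m + 1) the word 1 0 2 1 3 2 … m (m−1), called
-- zigzag 0 m, has length 2m = 2n − 2 and represents Cₙ: restricting it to an edge gives
-- 1 0 1, (i+1) (i+2) (i+1) (i+2), (m−1) m (m−1) or 0 m, all alternating; and for a non-edge
-- {a, b} one of its letters c has neither neighbour in {a, b}, so the blocks c (c−1) (c+1) c
-- leave a square c c in the restriction.  These restrictions are computed on lists of
-- numbers and transported to Fin n by the injective relabelling k ↦ k mod n.

open import Defs
open import Data.Bool using (true; false; if_then_else_)
open import Data.Empty using (⊥; ⊥-elim)
open import Data.Fin using (Fin; toℕ; zero; suc; _≟_)
open import Data.Fin.Properties using (toℕ-injective; toℕ<n; toℕ≤pred[n]; toℕ-fromℕ<; suc-injective)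
open import Data.List using (List; []; _∷_; length; filter; map; _++_)
open import Data.List.Membership.Propositional using (_∈_)
open import Data.List.Membership.Propositional.Properties using (∈-map⁺)
open import Data.List.Properties
  using (filter-accept; filter-reject; filter-none; filter-++; filter-≐; map-++; length-map)
open import Data.List.Relation.Unary.All using (All; []; _∷_; tabulate; universal)
import Data.List.Relation.Unary.All.Properties as All
open import Data.List.Relation.Unary.AllPairs using ([]; _∷_)
open import Data.List.Relation.Unary.Any using (here; there)
open import Data.List.Relation.Unary.Unique.Propositional using (Unique)
import Data.List.Relation.Unary.Unique.Propositional.Properties as Unique
open import Data.Nat
  using (ℕ; zero; suc; pred; _≤_; _<_; _*_; _∸_; _+_; _%_; z≤n; s≤s; s≤s⁻¹; NonZero; _≤?_)
  renaming (_≟_ to _≟ℕ_)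
open import Data.Nat.DivMod
  using (_/_; _mod_; %-distribˡ-+; m%n%n≡m%n; [m+n]%n≡m%n; m<n⇒m%n≡m; m≡m%n+[m/n]*n; n%n≡0)
open import Data.Nat.Properties
  using (+-identityʳ; +-suc; +-comm; +-cancelˡ-≡; +-cancelʳ-≡; +-monoʳ-≤; +-monoˡ-≤; ≤-refl; ≤-trans;
         <⇒≤; <⇒≱; <⇒≢; <-asym; <-trans; ≰⇒>; n<1+n; n≤1+n; m≤m+n; m≤n+m; ≤∧≢⇒<; m≤n⇒∃[o]m+o≡n;
         <-cmp; 1+n≢n; suc-pred; m≤n+o⇒m∸n≤o; +-commutativeSemigroup; +-0-commutativeMonoid;
         module ≤-Reasoning)
open import Data.Product using (Σ; ∃; _×_; _,_; proj₁; proj₂)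
open import Data.Sum as Sum using (_⊎_; inj₁; inj₂; [_,_])
open import Data.Unit using (⊤; tt)
open import Function using (_∘_)
open import Level using (0ℓ)
open import Relation.Binary.Definitions using (DecidableEquality; tri<; tri≈; tri>)
open import Relation.Binary.PropositionalEquality
  using (_≡_; refl; sym; trans; cong; cong₂; subst; subst₂; ≢-sym; module ≡-Reasoning)
open import Relation.Nullary using (¬_; yes; no; does; contradiction)
open import Relation.Nullary.Decidable using (_⊎-dec_)
open import Relation.Unary using (Pred; Decidable)
open import Algebra.Properties.CommutativeMonoid.Sum +-0-commutativeMonoid
  using (sum; ∑-distrib-+; sum-replicate-zero)
open import Algebra.Properties.CommutativeSemigroup +-commutativeSemigroup using (x∙yz≈y∙xz)

δ : ∀ {n} → Fin n → Fin n → ℕ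
δ x a = if does (x ≟ a) then 1 else 0

δ-refl : ∀ {n} (x : Fin n) → δ x x ≡ 1
δ-refl x with x ≟ x
... | yes _   = refl
... | no x≢x = ⊥-elim (x≢x refl)

δ-≢ : ∀ {n} {x a : Fin n} → ¬ x ≡ a → δ x a ≡ 0
δ-≢ {x = x} {a} x≢a with x ≟ a
... | yes x≡a = ⊥-elim (x≢a x≡a)
... | no _    = refl

occ : ∀ {n} → Fin n → Word n → ℕ
occ x []      = 0
occ x (a ∷ w) = δ x a + occ x w

∑-δ : ∀ {n} (a : Fin n) → sum (λ x → δ x a) ≡ 1
∑-δ {suc n} zero    = cong suc (sum-replicate-zero n)
∑-δ {suc n} (suc a) = ∑-δ a

∑-occ : ∀ {n} (w : Word n) → sum (λ x → occ x w) ≡ length w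
∑-occ {n} []  = sum-replicate-zero n
∑-occ (a ∷ w) = begin
  sum (λ x → δ x a + occ x w)             ≡⟨ ∑-distrib-+ (λ x → δ x a) (λ x → occ x w) ⟩
  sum (λ x → δ x a) + sum (λ x → occ x w) ≡⟨ cong₂ _+_ (∑-δ a) (∑-occ w) ⟩
  suc (length w)                          ∎
  where open ≡-Reasoning

occ-∈ : ∀ {n} {x : Fin n} {w} → x ∈ w → 1 ≤ occ x w
occ-∈ {x = x} {_ ∷ w} (here refl) rewrite δ-refl x = s≤s z≤n
occ-∈ {x = x} {a ∷ w} (there x∈w) = ≤-trans (occ-∈ x∈w) (m≤n+m (occ x w) (δ x a))

module _ {n} {P : Pred (Fin n) 0ℓ} (P? : Decidable P) where

  occ-filter-≤ : ∀ z w → occ z (filter P? w) ≤ occ z w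
  occ-filter-≤ z []      = z≤n
  occ-filter-≤ z (a ∷ w) with does (P? a)
  ... | true  = +-monoʳ-≤ (δ z a) (occ-filter-≤ z w)
  ... | false = ≤-trans (occ-filter-≤ z w) (m≤n+m (occ z w) (δ z a))

  occ-filter-reject : ∀ z w → ¬ P z → occ z (filter P? w) ≡ 0
  occ-filter-reject z []      ¬Pz = refl
  occ-filter-reject z (a ∷ w) ¬Pz with P? a
  ... | yes Pa = cong₂ _+_ (δ-≢ {x = z} {a} λ { refl → ¬Pz Pa }) (occ-filter-reject z w ¬Pz)
  ... | no  _  = occ-filter-reject z w ¬Pz

no-repeat-if-simple : ∀ {n} (w : Word n) → (∀ z → occ z w ≤ 1) → NoRepeatAdj w
no-repeat-if-simple []          _      = tt
no-repeat-if-simple (a ∷ [])     _      = tt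
no-repeat-if-simple (a ∷ b ∷ w) simple = a≢b , no-repeat-if-simple (b ∷ w) simple-tail
  where
  simple-tail : ∀ z → occ z (b ∷ w) ≤ 1
  simple-tail z = ≤-trans (m≤n+m _ (δ z a)) (simple z)
  a≢b : ¬ a ≡ b
  a≢b refl = <⇒≱ occurs-twice (simple a)
    where
    occurs-twice : 1 < occ a (a ∷ a ∷ w)
    occurs-twice rewrite δ-refl a = s≤s (s≤s z≤n)

alternate-if-once : ∀ {n} {a b : Fin n} (w : Word n) → occ a w ≤ 1 → occ b w ≤ 1 → Alternate w a b
alternate-if-once {a = a} {b} w once-a once-b = no-repeat-if-simple (restrict a b w) simple
  where
  P? = λ z → (z ≟ a) ⊎-dec (z ≟ b)
  simple : ∀ z → occ z (restrict a b w) ≤ 1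
  simple z with z ≟ a | z ≟ b
  ... | yes refl | _        = ≤-trans (occ-filter-≤ P? z w) once-a
  ... | no _     | yes refl = ≤-trans (occ-filter-≤ P? z w) once-b
  ... | no z≢a   | no z≢b   = subst (_≤ 1) (sym (occ-filter-reject P? z w [ z≢a , z≢b ])) z≤n

Small : ∀ {n} → (Fin n → ℕ) → Fin n → Set
Small f x = f x ≤ 1

-- If f ≥ 1 everywhere and at most k distinct points are small, then ∑ f ≥ 2n − k:
-- every point contributes at least 2, except the small ones which contribute at least 1.
sum-lower-bound : ∀ {n} k (f : Fin n → ℕ) → (∀ x → 1 ≤ f x) →
                  (∀ xs → Unique xs → All (Small f) xs → length xs ≤ k) →
                  n + n ≤ k + sum f
sum-lower-bound {zero}  k f pos few = z≤n
sum-lower-bound {suc n} k f pos few with f zero ≤? 1 | k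
... | yes small₀ | zero  = contradiction (few (zero ∷ []) ([] ∷ []) (small₀ ∷ [])) λ ()
... | yes small₀ | suc k = begin
  suc n + suc n        ≡⟨ cong suc (+-suc n n) ⟩
  2 + (n + n)          ≤⟨ s≤s (s≤s (sum-lower-bound k (f ∘ suc) (pos ∘ suc) few-tail)) ⟩
  2 + (k + S)          ≡⟨ cong suc (sym (+-suc k S)) ⟩
  suc k + (1 + S)      ≤⟨ +-monoʳ-≤ (suc k) (+-monoˡ-≤ S (pos zero)) ⟩
  suc k + (f zero + S) ∎
  where
  open ≤-Reasoning
  S = sum (f ∘ suc)
  -- 0 is small, so the remaining points may contain only k small ones.
  few-tail : ∀ xs → Unique xs → All (Small (f ∘ suc)) xs → length xs ≤ k
  few-tail xs unique small = s≤s⁻¹ (subst (_≤ suc k) (cong suc (length-map suc xs))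
    (few (zero ∷ map suc xs) (All.map⁺ (universal (λ _ ()) xs) ∷ Unique.map⁺ suc-injective unique)
         (small₀ ∷ All.map⁺ small)))
... | no big₀ | k = begin
  suc n + suc n      ≡⟨ cong suc (+-suc n n) ⟩
  2 + (n + n)        ≤⟨ s≤s (s≤s (sum-lower-bound k (f ∘ suc) (pos ∘ suc) few-tail)) ⟩
  2 + (k + S)        ≤⟨ +-monoˡ-≤ (k + S) (≰⇒> big₀) ⟩
  f zero + (k + S)   ≡⟨ x∙yz≈y∙xz (f zero) k S ⟩
  k + (f zero + S)   ∎
  where
  open ≤-Reasoning
  S = sum (f ∘ suc)
  few-tail : ∀ xs → Unique xs → All (Small (f ∘ suc)) xs → length xs ≤ k
  few-tail xs unique small = subst (_≤ k) (length-map suc xs)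
    (few (map suc xs) (Unique.map⁺ suc-injective unique) (All.map⁺ small))

module Cyclic (n : ℕ) .{{_ : NonZero n}} where

  next : ℕ → ℕ
  next a = suc a % n

  mod-absorbʳ : ∀ y x → (y + x % n) % n ≡ (y + x) % n
  mod-absorbʳ y x = begin
    (y + x % n) % n         ≡⟨ %-distribˡ-+ y (x % n) n ⟩
    (y % n + x % n % n) % n ≡⟨ cong (λ t → (y % n + t) % n) (m%n%n≡m%n x n) ⟩
    (y % n + x % n) % n     ≡⟨ %-distribˡ-+ y x n ⟨
    (y + x) % n             ∎
    where open ≡-Reasoning

  next³ : ∀ a → next (next (next a)) ≡ (3 + a) % n
  next³ a = begin
    suc (next (next a)) % n ≡⟨ cong (λ t → suc t % n) (mod-absorbʳ 1 (suc a)) ⟩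
    suc ((2 + a) % n) % n   ≡⟨ mod-absorbʳ 1 (2 + a) ⟩
    (3 + a) % n             ∎
    where open ≡-Reasoning

  -- … so for n ≥ 4 there is no cycle of length three: it would make n divide 3.
  no-3-cycle : 4 ≤ n → ∀ a → ¬ next (next (next a)) ≡ a
  no-3-cycle 4≤n a cycle = 3≢q*n (+-cancelˡ-≡ a 3 (q * n) (begin
    a + 3               ≡⟨ +-comm a 3 ⟩
    3 + a               ≡⟨ m≡m%n+[m/n]*n (3 + a) n ⟩
    (3 + a) % n + q * n ≡⟨ cong (_+ q * n) (trans (sym (next³ a)) cycle) ⟩
    a + q * n           ∎))
    where
    open ≡-Reasoning
    q = (3 + a) / n
    3≢q*n : ¬ 3 ≡ q * n
    3≢q*n 3≡q*n with q
    ... | zero  = contradiction 3≡q*n λ ()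
    ... | suc _ = <⇒≱ 4≤n (subst (n ≤_) (sym 3≡q*n) (m≤m+n n _))

  -- Adding n − 1 undoes a step on residues, so `next` is injective there.
  prev-next : ∀ {a} → a < n → (pred n + next a) % n ≡ a
  prev-next {a} a<n = begin
    (pred n + suc a % n) % n ≡⟨ mod-absorbʳ (pred n) (suc a) ⟩
    (pred n + suc a) % n     ≡⟨ cong (_% n) (trans (+-suc (pred n) a) (cong (_+ a) (suc-pred n))) ⟩
    (n + a) % n              ≡⟨ cong (_% n) (+-comm n a) ⟩
    (a + n) % n              ≡⟨ [m+n]%n≡m%n a n ⟩
    a % n                    ≡⟨ m<n⇒m%n≡m a<n ⟩
    a                        ∎
    where open ≡-Reasoning

  next-injective : ∀ {a b} → a < n → b < n → next a ≡ next b → a ≡ b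
  next-injective a<n b<n eq =
    trans (sym (prev-next a<n)) (trans (cong (λ t → (pred n + t) % n) eq) (prev-next b<n))

  next-below : ∀ {a} → suc a < n → next a ≡ suc a
  next-below = m<n⇒m%n≡m

  next-last : next (pred n) ≡ 0
  next-last = trans (cong (_% n) (suc-pred n)) (n%n≡0 n)

open Cyclic using (next; no-3-cycle; next-injective; next-below; next-last)

-- Cₙ has no triangle for n ≥ 4: each edge is a step of `next` in one direction, so a
-- triangle forces two equal vertices or a 3-cycle of `next`.
cycle-triangle-free : ∀ n .{{_ : NonZero n}} → 4 ≤ n → (x y z : Fin n) →
  ¬ x ≡ y → ¬ x ≡ z → ¬ y ≡ z → CycleAdj n x y → CycleAdj n x z → CycleAdj n y z → ⊥
cycle-triangle-free n 4≤n x y z x≢y x≢z y≢z (inj₁ y=x⁺) (inj₁ z=x⁺) _ =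
  y≢z (toℕ-injective (trans y=x⁺ (sym z=x⁺)))
cycle-triangle-free n 4≤n x y z x≢y x≢z y≢z (inj₁ y=x⁺) (inj₂ x=z⁺) (inj₁ z=y⁺) =
  no-3-cycle n 4≤n (toℕ x) (sym (trans x=z⁺ (cong (next n) (trans z=y⁺ (cong (next n) y=x⁺)))))
cycle-triangle-free n 4≤n x y z x≢y x≢z y≢z (inj₁ _) (inj₂ x=z⁺) (inj₂ y=z⁺) =
  x≢y (toℕ-injective (trans x=z⁺ (sym y=z⁺)))
cycle-triangle-free n 4≤n x y z x≢y x≢z y≢z (inj₂ x=y⁺) (inj₁ z=x⁺) (inj₁ z=y⁺) =
  x≢z (toℕ-injective (trans x=y⁺ (sym z=y⁺)))
cycle-triangle-free n 4≤n x y z x≢y x≢z y≢z (inj₂ x=y⁺) (inj₁ z=x⁺) (inj₂ y=z⁺) =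
  no-3-cycle n 4≤n (toℕ y) (sym (trans y=z⁺ (cong (next n) (trans z=x⁺ (cong (next n) x=y⁺)))))
cycle-triangle-free n 4≤n x y z x≢y x≢z y≢z (inj₂ x=y⁺) (inj₂ x=z⁺) _ =
  y≢z (toℕ-injective (next-injective n (toℕ<n y) (toℕ<n z) (trans (sym x=y⁺) x=z⁺)))

module _ (n : ℕ) .{{_ : NonZero n}} (4≤n : 4 ≤ n) (w : Word n) (rep : Represents (CycleAdj n) w) where

  -- At most two letters occur only once in w: any two such letters alternate, hence are
  -- adjacent in Cₙ, and Cₙ has no triangle.
  few-singletons : ∀ xs → Unique xs → All (Small (λ x → occ x w)) xs → length xs ≤ 2
  few-singletons []           _ _ = z≤n
  few-singletons (_ ∷ [])      _ _ = s≤s z≤n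
  few-singletons (_ ∷ _ ∷ [])  _ _ = s≤s (s≤s z≤n)
  few-singletons (x ∷ y ∷ z ∷ _) ((x≢y ∷ x≢z ∷ _) ∷ (y≢z ∷ _) ∷ _) (once-x ∷ once-y ∷ once-z ∷ _) =
    ⊥-elim (cycle-triangle-free n 4≤n x y z x≢y x≢z y≢z
             (adjacent x≢y once-x once-y) (adjacent x≢z once-x once-z) (adjacent y≢z once-y once-z))
    where
    adjacent : ∀ {a b} → ¬ a ≡ b → occ a w ≤ 1 → occ b w ≤ 1 → CycleAdj n a b
    adjacent {a} {b} a≢b once-a once-b = proj₂ (proj₂ rep a b a≢b) (alternate-if-once w once-a once-b)

  lower-bound : 2 * n ∸ 2 ≤ length w
  lower-bound = m≤n+o⇒m∸n≤o (2 * n) 2 (begin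
    2 * n                   ≡⟨ cong (n +_) (+-identityʳ n) ⟩
    n + n                   ≤⟨ sum-lower-bound 2 (λ x → occ x w) (λ x → occ-∈ (proj₁ rep x)) few-singletons ⟩
    2 + sum (λ x → occ x w) ≡⟨ cong (2 +_) (∑-occ w) ⟩
    2 + length w            ∎)
    where open ≤-Reasoning

restrictTo : ∀ {A : Set} → DecidableEquality A → A → A → List A → List A
restrictTo _≟_ a b = filter (λ z → (z ≟ a) ⊎-dec (z ≟ b))

restrictTo-map : ∀ {A B : Set} (_≟A_ : DecidableEquality A) (_≟B_ : DecidableEquality B)
  (S : A → Set) (f : A → B) → (∀ {u v} → S u → S v → f u ≡ f v → u ≡ v) →
  ∀ {a b} L → S a → S b → All S L →
  restrictTo _≟B_ (f a) (f b) (map f L) ≡ map f (restrictTo _≟A_ a b L)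
restrictTo-map _≟A_ _≟B_ S f inj []      Sa Sb []        = refl
restrictTo-map _≟A_ _≟B_ S f inj {a} {b} (z ∷ L) Sa Sb (Sz ∷ SL) with (z ≟A a) ⊎-dec (z ≟A b)
... | yes z∈ab = begin
  restrictTo _≟B_ (f a) (f b) (f z ∷ map f L) ≡⟨ filter-accept Q? (Sum.map (cong f) (cong f) z∈ab) ⟩
  f z ∷ restrictTo _≟B_ (f a) (f b) (map f L) ≡⟨ cong (f z ∷_) (restrictTo-map _≟A_ _≟B_ S f inj L Sa Sb SL) ⟩
  map f (z ∷ restrictTo _≟A_ a b L)          ≡⟨ cong (map f) (filter-accept P? z∈ab) ⟨
  map f (restrictTo _≟A_ a b (z ∷ L))        ∎
  where
  open ≡-Reasoning
  P? = λ x → (x ≟A a) ⊎-dec (x ≟A b)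
  Q? = λ y → (y ≟B f a) ⊎-dec (y ≟B f b)
... | no z∉ab = begin
  restrictTo _≟B_ (f a) (f b) (f z ∷ map f L) ≡⟨ filter-reject Q? (z∉ab ∘ Sum.map (inj Sz Sa) (inj Sz Sb)) ⟩
  restrictTo _≟B_ (f a) (f b) (map f L)       ≡⟨ restrictTo-map _≟A_ _≟B_ S f inj L Sa Sb SL ⟩
  map f (restrictTo _≟A_ a b L)               ≡⟨ cong (map f) (filter-reject P? z∉ab) ⟨
  map f (restrictTo _≟A_ a b (z ∷ L))         ∎
  where
  open ≡-Reasoning
  P? = λ x → (x ≟A a) ⊎-dec (x ≟A b)
  Q? = λ y → (y ≟B f a) ⊎-dec (y ≟B f b)

restrict-sym : ∀ {n} (x y : Fin n) w → restrict x y w ≡ restrict y x w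
restrict-sym x y =
  filter-≐ (λ z → (z ≟ x) ⊎-dec (z ≟ y)) (λ z → (z ≟ y) ⊎-dec (z ≟ x)) (Sum.swap , Sum.swap)

square-repeats : ∀ {n} (u : Word n) c v → ¬ NoRepeatAdj (u ++ c ∷ c ∷ v)
square-repeats []          c v (c≢c , _) = c≢c refl
square-repeats (_ ∷ [])     c v (_ , nr) = square-repeats [] c v nr
square-repeats (_ ∷ d ∷ u) c v (_ , nr) = square-repeats (d ∷ u) c v nr

-- zigzag j k = (j+1) j (j+2) (j+1) … (j+k) (j+k−1), the blocks (i+1) i for j ≤ i < j+k.
-- The word 1 0 2 1 … m (m−1) = zigzag 0 m will represent the cycle on 0, …, m.
zigzag : ℕ → ℕ → List ℕ
zigzag j zero    = []
zigzag j (suc k) = suc j ∷ j ∷ zigzag (suc j) k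

zigzag-++ : ∀ j k l → zigzag j (k + l) ≡ zigzag j k ++ zigzag (j + k) l
zigzag-++ j zero    l = cong (λ t → zigzag t l) (sym (+-identityʳ j))
zigzag-++ j (suc k) l = cong (λ t → suc j ∷ j ∷ t)
  (trans (zigzag-++ (suc j) k l) (cong (λ t → zigzag (suc j) k ++ zigzag t l) (sym (+-suc j k))))

zigzag-shift : ∀ i j k → zigzag (j + i) k ≡ map (_+ i) (zigzag j k)
zigzag-shift i j zero    = refl
zigzag-shift i j (suc k) = cong (λ t → suc (j + i) ∷ j + i ∷ t) (zigzag-shift i (suc j) k)

length-zigzag : ∀ j k → length (zigzag j k) ≡ k + k
length-zigzag j zero    = refl
length-zigzag j (suc k) = cong suc (trans (cong suc (length-zigzag (suc j) k)) (sym (+-suc k k)))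

∈-zigzag : ∀ j k d → d ≤ suc k → j + d ∈ zigzag j (suc k)
∈-zigzag j k       zero          _         = subst (_∈ zigzag j (suc k)) (sym (+-identityʳ j)) (there (here refl))
∈-zigzag j k       (suc zero)    _         = here (trans (+-suc j 0) (cong suc (+-identityʳ j)))
∈-zigzag j zero    (suc (suc d)) (s≤s ())
∈-zigzag j (suc k) (suc (suc d)) (s≤s d≤k) =
  there (there (subst (_∈ zigzag (suc j) (suc k)) (sym (+-suc j (suc d))) (∈-zigzag (suc j) k (suc d) d≤k)))

zigzag-range : ∀ {v} j k → v ∈ zigzag j k → j ≤ v × v ≤ j + k
zigzag-range j (suc k) (here refl)         = <⇒≤ (n<1+n j) , subst (suc j ≤_) (sym (+-suc j k)) (s≤s (m≤m+n j k))
zigzag-range j (suc k) (there (here refl)) = ≤-refl , m≤m+n j (suc k)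
zigzag-range j (suc k) (there (there v∈))  with zigzag-range (suc j) k v∈
... | j<v , v≤ = <⇒≤ j<v , subst (_≤_ _) (sym (+-suc j k)) v≤

only : ℕ → ℕ → List ℕ → List ℕ
only = restrictTo _≟ℕ_

only-keep : ∀ {a b z} t → z ≡ a ⊎ z ≡ b → only a b (z ∷ t) ≡ z ∷ only a b t
only-keep {a} {b} t = filter-accept (λ x → (x ≟ℕ a) ⊎-dec (x ≟ℕ b))

only-skip : ∀ {a b z} t → ¬ (z ≡ a ⊎ z ≡ b) → only a b (z ∷ t) ≡ only a b t
only-skip {a} {b} t = filter-reject (λ x → (x ≟ℕ a) ⊎-dec (x ≟ℕ b))

only-absent : ∀ {a b} L → (∀ {v} → v ∈ L → ¬ (v ≡ a ⊎ v ≡ b)) → only a b L ≡ []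
only-absent {a} {b} L absent = filter-none (λ x → (x ≟ℕ a) ⊎-dec (x ≟ℕ b)) (tabulate absent)

zigzag-misses-above : ∀ {a b} i → i < a → i < b → only a b (zigzag 0 i) ≡ []
zigzag-misses-above i i<a i<b = only-absent (zigzag 0 i) λ v∈ →
  let v≤i = proj₂ (zigzag-range 0 i v∈) in
  λ { (inj₁ refl) → <⇒≱ i<a v≤i ; (inj₂ refl) → <⇒≱ i<b v≤i }

zigzag-misses-below : ∀ {a b} j k → a < j → b < j → only a b (zigzag j k) ≡ []
zigzag-misses-below j k a<j b<j = only-absent (zigzag j k) λ v∈ →
  let j≤v = proj₁ (zigzag-range j k v∈) in
  λ { (inj₁ refl) → <⇒≱ a<j j≤v ; (inj₂ refl) → <⇒≱ b<j j≤v }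

only-translate : ∀ {a b} i k →
  only (suc a + i) (suc b + i) (zigzag 0 (i + k)) ≡ map (_+ i) (only (suc a) (suc b) (zigzag 0 k))
only-translate {a} {b} i k = begin
  only a′ b′ (zigzag 0 (i + k))                  ≡⟨ cong (only a′ b′) (zigzag-++ 0 i k) ⟩
  only a′ b′ (zigzag 0 i ++ zigzag i k)          ≡⟨ filter-++ (λ x → (x ≟ℕ a′) ⊎-dec (x ≟ℕ b′)) (zigzag 0 i) _ ⟩
  only a′ b′ (zigzag 0 i) ++ only a′ b′ (zigzag i k)
    ≡⟨ cong (_++ only a′ b′ (zigzag i k)) (zigzag-misses-above i (s≤s (m≤n+m i a)) (s≤s (m≤n+m i b))) ⟩
  only a′ b′ (zigzag i k)                        ≡⟨ cong (only a′ b′) (zigzag-shift i 0 k) ⟩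
  only a′ b′ (map (_+ i) (zigzag 0 k))           ≡⟨ restrictTo-map _≟ℕ_ _≟ℕ_ (λ _ → ⊤) (_+ i)
                                                      (λ _ _ → +-cancelʳ-≡ _ _ _) (zigzag 0 k) tt tt (universal _ _) ⟩
  map (_+ i) (only (suc a) (suc b) (zigzag 0 k)) ∎
  where
  open ≡-Reasoning
  a′ = suc a + i
  b′ = suc b + i

only-edge-01 : ∀ k → only 0 1 (zigzag 0 (3 + k)) ≡ 1 ∷ 0 ∷ 1 ∷ []
only-edge-01 k = cong (λ t → 1 ∷ 0 ∷ 1 ∷ t) (zigzag-misses-below 2 (suc k) (s≤s z≤n) (s≤s (s≤s z≤n)))

only-edge-inner : ∀ i r → only (1 + i) (2 + i) (zigzag 0 (i + (3 + r))) ≡ map (_+ i) (1 ∷ 2 ∷ 1 ∷ 2 ∷ [])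
only-edge-inner i r = trans (only-translate i (3 + r))
  (cong (λ t → map (_+ i) (1 ∷ 2 ∷ 1 ∷ 2 ∷ t))
        (zigzag-misses-below 3 r (s≤s (s≤s z≤n)) (s≤s (s≤s (s≤s z≤n)))))

only-edge-last : ∀ i → only (1 + i) (2 + i) (zigzag 0 (i + 2)) ≡ map (_+ i) (1 ∷ 2 ∷ 1 ∷ [])
only-edge-last i = only-translate i 2

only-edge-closing : ∀ r → only 0 (2 + r) (zigzag 0 (2 + r)) ≡ 0 ∷ 2 + r ∷ []
only-edge-closing r = cong (0 ∷_) (begin
  only 0 m (zigzag 1 (suc r))
    ≡⟨ cong (λ t → only 0 m (zigzag 1 t)) (+-comm 1 r) ⟩
  only 0 m (zigzag 1 (r + 1))
    ≡⟨ cong (only 0 m) (zigzag-++ 1 r 1) ⟩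
  only 0 m (zigzag 1 r ++ m ∷ 1 + r ∷ [])
    ≡⟨ filter-++ (λ x → (x ≟ℕ 0) ⊎-dec (x ≟ℕ m)) (zigzag 1 r) _ ⟩
  only 0 m (zigzag 1 r) ++ only 0 m (m ∷ 1 + r ∷ [])
    ≡⟨ cong₂ _++_ (only-absent (zigzag 1 r) inside) (only-keep {0} {m} (1 + r ∷ []) (inj₂ refl)) ⟩
  m ∷ only 0 m (1 + r ∷ [])
    ≡⟨ cong (m ∷_) (only-skip {0} {m} {1 + r} [] m−1∉) ⟩
  m ∷ []
    ∎)
  where
  open ≡-Reasoning
  m = 2 + r
  m−1∉ : ¬ (1 + r ≡ 0 ⊎ 1 + r ≡ m)
  m−1∉ (inj₁ ())
  m−1∉ (inj₂ m−1≡m) = 1+n≢n (sym m−1≡m)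
  inside : ∀ {v} → v ∈ zigzag 1 r → ¬ (v ≡ 0 ⊎ v ≡ m)
  inside v∈ (inj₁ refl) = <⇒≱ (s≤s z≤n) (proj₁ (zigzag-range 1 r v∈))
  inside v∈ (inj₂ refl) = <⇒≱ ≤-refl (proj₂ (zigzag-range 1 r v∈))

only-square : ∀ {a b} i r → (suc i ≡ a ⊎ suc i ≡ b) → ¬ (i ≡ a ⊎ i ≡ b) → ¬ (2 + i ≡ a ⊎ 2 + i ≡ b) →
  only a b (zigzag 0 (i + (2 + r))) ≡ only a b (zigzag 0 i) ++ suc i ∷ suc i ∷ only a b (zigzag (2 + i) r)
only-square {a} {b} i r c∈ i∉ i+2∉ = begin
  only a b (zigzag 0 (i + (2 + r)))               ≡⟨ cong (only a b) (zigzag-++ 0 i (2 + r)) ⟩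
  only a b (zigzag 0 i ++ zigzag i (2 + r))       ≡⟨ filter-++ (λ x → (x ≟ℕ a) ⊎-dec (x ≟ℕ b)) (zigzag 0 i) _ ⟩
  only a b (zigzag 0 i) ++ only a b (suc i ∷ i ∷ 2 + i ∷ suc i ∷ T)
    ≡⟨ cong (only a b (zigzag 0 i) ++_) block ⟩
  only a b (zigzag 0 i) ++ suc i ∷ suc i ∷ only a b T ∎
  where
  open ≡-Reasoning
  T = zigzag (2 + i) r
  block : only a b (suc i ∷ i ∷ 2 + i ∷ suc i ∷ T) ≡ suc i ∷ suc i ∷ only a b T
  block = begin
    only a b (suc i ∷ i ∷ 2 + i ∷ suc i ∷ T) ≡⟨ only-keep _ c∈ ⟩
    suc i ∷ only a b (i ∷ 2 + i ∷ suc i ∷ T) ≡⟨ cong (suc i ∷_) (only-skip _ i∉) ⟩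
    suc i ∷ only a b (2 + i ∷ suc i ∷ T)     ≡⟨ cong (suc i ∷_) (only-skip _ i+2∉) ⟩
    suc i ∷ only a b (suc i ∷ T)             ≡⟨ cong (suc i ∷_) (only-keep _ c∈) ⟩
    suc i ∷ suc i ∷ only a b T               ∎

vertex : ∀ {m} → ℕ → Fin (suc m)
vertex {m} k = k mod suc m

toℕ-vertex : ∀ {m k} → k ≤ m → toℕ (vertex {m} k) ≡ k
toℕ-vertex k≤m = trans (toℕ-fromℕ< _) (m<n⇒m%n≡m (s≤s k≤m))

vertex-toℕ : ∀ {m} (x : Fin (suc m)) → vertex (toℕ x) ≡ x
vertex-toℕ x = toℕ-injective (toℕ-vertex (toℕ≤pred[n] x))

vertex-injective : ∀ {m k l} → k ≤ m → l ≤ m → vertex {m} k ≡ vertex l → k ≡ l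
vertex-injective k≤m l≤m eq = trans (sym (toℕ-vertex k≤m)) (trans (cong toℕ eq) (toℕ-vertex l≤m))

cycleWord : (m : ℕ) → Word (suc m)
cycleWord m = map vertex (zigzag 0 m)

restrict-cycleWord : ∀ {m a b} → a ≤ m → b ≤ m →
  restrict (vertex a) (vertex b) (cycleWord m) ≡ map vertex (only a b (zigzag 0 m))
restrict-cycleWord {m} a≤m b≤m = restrictTo-map _≟ℕ_ _≟_ (_≤ m) vertex vertex-injective (zigzag 0 m) a≤m b≤m
  (tabulate (λ v∈ → proj₂ (zigzag-range 0 m v∈)))

vertex-≢ : ∀ {m k l} → k ≤ m → l ≤ m → ¬ k ≡ l → ¬ vertex {m} k ≡ vertex l
vertex-≢ k≤m l≤m k≢l = k≢l ∘ vertex-injective k≤m l≤m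

alternates-via : ∀ {m a b} L → a ≤ m → b ≤ m → only a b (zigzag 0 m) ≡ L →
  NoRepeatAdj (map vertex L) → Alternate (cycleWord m) (vertex a) (vertex b)
alternates-via L a≤m b≤m eq = subst NoRepeatAdj (sym (trans (restrict-cycleWord a≤m b≤m) (cong (map vertex) eq)))

square-breaks-alternation : ∀ {a b} i r → a ≤ i + (2 + r) → b ≤ i + (2 + r) →
  (suc i ≡ a ⊎ suc i ≡ b) → ¬ (i ≡ a ⊎ i ≡ b) → ¬ (2 + i ≡ a ⊎ 2 + i ≡ b) →
  ¬ Alternate (cycleWord (i + (2 + r))) (vertex a) (vertex b)
square-breaks-alternation {a} {b} i r a≤m b≤m c∈ i∉ i+2∉ alt =
  square-repeats (map vertex u) (vertex (suc i)) (map vertex v) (subst NoRepeatAdj (begin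
    restrict (vertex a) (vertex b) (cycleWord (i + (2 + r))) ≡⟨ restrict-cycleWord a≤m b≤m ⟩
    map vertex (only a b (zigzag 0 (i + (2 + r))))          ≡⟨ cong (map vertex) (only-square i r c∈ i∉ i+2∉) ⟩
    map vertex (u ++ suc i ∷ suc i ∷ v)                      ≡⟨ map-++ vertex u (suc i ∷ suc i ∷ v) ⟩
    map vertex u ++ map vertex (suc i ∷ suc i ∷ v)           ∎) alt)
  where
  open ≡-Reasoning
  u = only a b (zigzag 0 i)
  v = only a b (zigzag (2 + i) r)

Edge : ℕ → ℕ → ℕ → Set
Edge m a b = b ≡ suc a ⊎ (a ≡ 0 × b ≡ m)

-- If i + 2 ≤ m then m = i + (2 + r): the word splits after the first i blocks and two more.
beyond : ∀ {i m} → 2 + i ≤ m → ∃ λ r → i + (2 + r) ≡ m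
beyond {i} 2+i≤m with m≤n⇒∃[o]m+o≡n 2+i≤m
... | r , eq = r , trans (+-suc i (suc r)) (trans (cong suc (+-suc i r)) eq)

edge-alternates : ∀ m a b → 3 ≤ m → b ≤ m → Edge m a b → Alternate (cycleWord m) (vertex a) (vertex b)
edge-alternates (suc zero)       _ _ (s≤s ()) _ _
edge-alternates (suc (suc zero)) _ _ (s≤s (s≤s ())) _ _
edge-alternates (suc (suc (suc k))) zero .1 (s≤s (s≤s (s≤s z≤n))) _ (inj₁ refl) =
  alternates-via (1 ∷ 0 ∷ 1 ∷ []) z≤n 1≤m (only-edge-01 k) (≢-sym v0≢v1 , v0≢v1 , tt)
  where
  1≤m = s≤s z≤n
  v0≢v1 = vertex-≢ z≤n 1≤m (λ ())
edge-alternates m (suc i) .(suc (suc i)) _ b≤m (inj₁ refl) with beyond b≤m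
... | zero  , refl = alternates-via _ a≤m b≤m (only-edge-last i) (va≢vb , ≢-sym va≢vb , tt)
  where
  a≤m = ≤-trans (n≤1+n _) b≤m
  va≢vb = vertex-≢ a≤m b≤m (≢-sym 1+n≢n)
... | suc r , refl = alternates-via _ a≤m b≤m (only-edge-inner i r) (va≢vb , ≢-sym va≢vb , va≢vb , tt)
  where
  a≤m = ≤-trans (n≤1+n _) b≤m
  va≢vb = vertex-≢ a≤m b≤m (≢-sym 1+n≢n)
edge-alternates (suc (suc (suc k))) .zero .(suc (suc (suc k))) (s≤s (s≤s (s≤s z≤n))) b≤m (inj₂ (refl , refl)) =
  alternates-via _ z≤n b≤m (only-edge-closing (suc k)) (vertex-≢ z≤n b≤m (λ ()) , tt)

-- Every pair of vertices that alternates in the word is an edge: otherwise one of them, c,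
-- has neither neighbour c − 1, c + 1 in the pair, and the blocks around c give a square c c.
alternation-is-edge : ∀ m a b → a < b → b ≤ m → Alternate (cycleWord m) (vertex a) (vertex b) → Edge m a b
alternation-is-edge m zero (suc zero) _ _ _ = inj₁ refl
alternation-is-edge m zero b@(suc (suc j)) _ b≤m alt with b ≟ℕ m
... | yes b≡m = inj₂ (refl , b≡m)
... | no  b≢m with beyond (≤∧≢⇒< b≤m b≢m)
...   | r , refl = ⊥-elim (square-breaks-alternation (suc j) r z≤n b≤m (inj₂ refl)
                     (λ { (inj₁ ()) ; (inj₂ j+1≡b) → 1+n≢n (sym j+1≡b) })
                     (λ { (inj₁ ()) ; (inj₂ j+3≡b) → 1+n≢n j+3≡b }) alt)
alternation-is-edge m a@(suc i) b a<b b≤m alt with b ≟ℕ suc a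
... | yes b≡a+1 = inj₁ b≡a+1
... | no  b≢a+1 with beyond (≤-trans a<b b≤m)
...   | r , refl = ⊥-elim (square-breaks-alternation i r (≤-trans (<⇒≤ a<b) b≤m) b≤m (inj₁ refl)
                     (λ { (inj₁ i≡a) → 1+n≢n (sym i≡a) ; (inj₂ refl) → <⇒≢ (<-trans (n<1+n i) a<b) refl })
                     (λ { (inj₁ a+1≡a) → 1+n≢n a+1≡a ; (inj₂ a+1≡b) → b≢a+1 (sym a+1≡b) }) alt)

adjacent⇒edge : ∀ {m} (x y : Fin (suc m)) → toℕ x < toℕ y → CycleAdj (suc m) x y → Edge m (toℕ x) (toℕ y)
adjacent⇒edge {m} x y x<y (inj₁ y=x⁺) =
  inj₁ (trans y=x⁺ (next-below (suc m) (s≤s (≤-trans x<y (toℕ≤pred[n] y)))))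
adjacent⇒edge {m} x y x<y (inj₂ x=y⁺) with toℕ y ≟ℕ m
... | yes y≡m = inj₂ (trans x=y⁺ (trans (cong (next (suc m)) y≡m) (next-last (suc m))) , y≡m)
... | no  y≢m = contradiction x<y (<-asym (subst (toℕ y <_) (sym y⁺≡x) (n<1+n (toℕ y))))
  where
  y⁺≡x : toℕ x ≡ suc (toℕ y)
  y⁺≡x = trans x=y⁺ (next-below (suc m) (s≤s (≤∧≢⇒< (toℕ≤pred[n] y) y≢m)))

edge⇒adjacent : ∀ {m} (x y : Fin (suc m)) → Edge m (toℕ x) (toℕ y) → CycleAdj (suc m) x y
edge⇒adjacent {m} x y (inj₁ y≡x+1) =
  inj₁ (trans y≡x+1 (sym (next-below (suc m) (s≤s (subst (_≤ m) y≡x+1 (toℕ≤pred[n] y))))))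
edge⇒adjacent {m} x y (inj₂ (x≡0 , y≡m)) =
  inj₂ (trans x≡0 (sym (trans (cong (next (suc m)) y≡m) (next-last (suc m)))))

pairs-from-sorted : ∀ {n} (G : Graph n) (w : Word n) → (∀ {x y} → G x y → G y x) →
  (∀ x y → toℕ x < toℕ y → (G x y → Alternate w x y) × (Alternate w x y → G x y)) →
  ∀ x y → ¬ x ≡ y → (G x y → Alternate w x y) × (Alternate w x y → G x y)
pairs-from-sorted G w G-sym sorted x y x≢y with <-cmp (toℕ x) (toℕ y)
... | tri< x<y _ _ = sorted x y x<y
... | tri≈ _ x≡y _ = ⊥-elim (x≢y (toℕ-injective x≡y))
... | tri> _ _ y<x = (flip ∘ proj₁ (sorted y x y<x) ∘ G-sym) , (G-sym ∘ proj₂ (sorted y x y<x) ∘ flip)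
  where
  flip : ∀ {u v} → Alternate w u v → Alternate w v u
  flip {u} {v} = subst NoRepeatAdj (restrict-sym u v w)

cycleWord-represents : ∀ m → 3 ≤ m → Represents (CycleAdj (suc m)) (cycleWord m)
cycleWord-represents m@(suc k) 3≤m = occurs , pairs-from-sorted (CycleAdj (suc m)) (cycleWord m) Sum.swap sorted
  where
  occurs : ∀ x → x ∈ cycleWord m
  occurs x = subst (_∈ cycleWord m) (vertex-toℕ x) (∈-map⁺ vertex (∈-zigzag 0 k (toℕ x) (toℕ≤pred[n] x)))
  sorted : ∀ x y → toℕ x < toℕ y →
           (CycleAdj (suc m) x y → Alternate (cycleWord m) x y) × (Alternate (cycleWord m) x y → CycleAdj (suc m) x y)
  sorted x y x<y = to-vertices ∘ edge-alternates m (toℕ x) (toℕ y) 3≤m y≤m ∘ adjacent⇒edge x y x<y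
                 , edge⇒adjacent x y ∘ alternation-is-edge m (toℕ x) (toℕ y) x<y y≤m ∘ from-vertices
    where
    y≤m = toℕ≤pred[n] y
    to-vertices : Alternate (cycleWord m) (vertex (toℕ x)) (vertex (toℕ y)) → Alternate (cycleWord m) x y
    to-vertices = subst₂ (Alternate (cycleWord m)) (vertex-toℕ x) (vertex-toℕ y)
    from-vertices : Alternate (cycleWord m) x y → Alternate (cycleWord m) (vertex (toℕ x)) (vertex (toℕ y))
    from-vertices = subst₂ (Alternate (cycleWord m)) (sym (vertex-toℕ x)) (sym (vertex-toℕ y))

length-cycleWord : ∀ m → length (cycleWord m) ≡ 2 * suc m ∸ 2
length-cycleWord m = begin
  length (map vertex (zigzag 0 m)) ≡⟨ length-map vertex (zigzag 0 m) ⟩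
  length (zigzag 0 m)              ≡⟨ length-zigzag 0 m ⟩
  m + m                            ≡⟨ cong (m +_) (+-identityʳ m) ⟨
  m + (m + 0)                      ≡⟨ cong (_∸ 1) (+-suc m (m + 0)) ⟨
  2 * suc m ∸ 2                    ∎
  where open ≡-Reasoning

theorem5 : (n : ℕ) → (hn : 4 ≤ n) →
    Σ (Word n) (λ w → Represents (CycleAdj n {{nonZero4 hn}}) w × length w ≡ 2 * n ∸ 2)
    × (∀ (w : Word n) → Represents (CycleAdj n {{nonZero4 hn}}) w → 2 * n ∸ 2 ≤ length w)
theorem5 (suc m) hn@(s≤s 3≤m) =
  (cycleWord m , cycleWord-represents m 3≤m , length-cycleWord m) ,
  λ w rep → lower-bound (suc m) hn w rep
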